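{- For every integer $k \ge 1$, $\mathrm{sat}(k) = U^{(k)}(0)$, where $U^{(k)}$ denotes the $k$-th iterate of $U$.
   Context: Every $n \in \mathbb N=\{0,1,2,\dots\}$ has a unique expression $n = \frac12\sum_{i=0}^k a_i (3/2)^i$ with digits $a_i \in \{0,1,2\}$ and $a_k \neq 0$ if $n \ge 1$; its representation in rational base $3/2$ is the word $\langle n\rangle = a_k\cdots a_0 \in \{0,1,2\}^*$, with $\langle 0\rangle$ the empty word. $|w|$ denotes the length of a word $w$. For $k \ge 1$, $\mathrm{sat}(k) = \max\{n \in \mathbb N : |\langle n\rangle| = k\}$. $U:\mathbb N \to \mathbb N$ is defined by $U(n) = (3n+2)/2$ if $n$ is even and $U(n) = (3n+1)/2$ if $n$ is odd. -}

module Defs where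

open import Data.Nat using (ℕ; zero; suc; _+_; _*_; _^_; _≤_; _/_; _%_)
open import Data.Fin using (Fin; toℕ)
open import Data.List using (List; []; _∷_; length; reverse)
open import Data.Product using (_×_; ∃)
open import Relation.Binary.PropositionalEquality using (_≡_; _≢_)
open import Relation.Nullary using (¬_)

-- A word over the digit alphabet {0,1,2}, written most significant digit first:
-- a_k ∷ ... ∷ a_0 ∷ []  represents  a_k ⋯ a_0.
Digit : Set
Digit = Fin 3

-- For a digit list given LEAST significant digit first (a_0 ∷ a_1 ∷ ... ∷ a_k),
-- scaledValLSB computes  Σ_i a_i 3^i 2^(L-1-i)  with L the length,
-- i.e. 2^L · (1/2) Σ_i a_i (3/2)^i.
scaledValLSB : List Digit → ℕ
scaledValLSB []      = 0
scaledValLSB (a ∷ r) = toℕ a * 2 ^ length r + 3 * scaledValLSB r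

scaledVal : List Digit → ℕ
scaledVal w = scaledValLSB (reverse w)

LeadingNonZero : List Digit → Set
LeadingNonZero []      = Data.Unit.⊤ where import Data.Unit
LeadingNonZero (a ∷ _) = toℕ a ≢ 0

-- w is the base-3/2 representation ⟨n⟩ of n:
--   n = (1/2) Σ_i a_i (3/2)^i  (multiplied through by 2^|w|), leading digit nonzero.
IsRep : ℕ → List Digit → Set
IsRep n w = LeadingNonZero w × (2 ^ length w * n ≡ scaledVal w)

U : ℕ → ℕ
U n with n % 2
... | zero  = (3 * n + 2) / 2
... | suc _ = (3 * n + 1) / 2

iter : ℕ → (ℕ → ℕ) → ℕ → ℕ
iter zero    f x = x
iter (suc k) f x = f (iter k f x)

IsSat : ℕ → ℕ → Set
IsSat k m = (∃ λ w → IsRep m w × length w ≡ k)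
          × (∀ n w → IsRep n w → length w ≡ k → n ≤ m)

-- Appending a digit a to a word of value m gives a word of value n exactly when 2n = a + 3m
-- (RepLSB lists digits least significant first, so appending is _∷_). Conversely,
-- since powers of 2 are coprime to 3, deleting the last digit of a representation leaves a
-- representation. So a word of length k + 1 has value at most the largest n with
-- 2n ≤ 3 sat(k) + 2, which is U(sat(k)); appending the digit 2U(m) − 3m ∈ {1, 2} attains it.
module Submission where

open import Defs
open import Data.Nat using (ℕ; zero; suc; _+_; _*_; _^_; _≤_; _/_; _%_; s≤s)
open import Data.Nat.Properties
  using ( +-comm; *-comm; *-assoc; *-suc; *-identityˡ; *-cancelˡ-≡; *-cancelˡ-<; m^n≢0
        ; ≤-reflexive; +-mono-≤; +-monoˡ-≤; *-monoʳ-≤; n<1+n; m<1+n⇒m≤n; n≢0⇒n>0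
        ; module ≤-Reasoning)
open import Data.Nat.DivMod using (m≡m%n+[m/n]*n; m%n<n; m*[n/m]≡n)
open import Data.Nat.Divisibility
  using (_∣_; divides; ∣-trans; m∣m*n; n∣m*n; ∣m+n∣m⇒∣n; *-monoʳ-∣; *-cancelˡ-∣; 1∣_)
open import Data.Nat.Tactic.RingSolver using (solve; solve-∀)
open import Data.Fin using (zero; suc; toℕ)
open import Data.Fin.Properties using (toℕ<n)
open import Data.List using (List; []; _∷_; length; reverse; _++_)
open import Data.List.Properties using (unfold-reverse; reverse-involutive; length-reverse)
open import Data.Product using (_×_; _,_; ∃)
open import Data.Unit using (tt)
open import Relation.Binary.PropositionalEquality
  using (_≡_; _≢_; refl; sym; trans; cong; subst; subst₂; module ≡-Reasoning)

U-digit : ℕ → Digit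
U-digit n with n % 2
... | zero  = suc (suc zero)
... | suc _ = suc zero

U-digit≢0 : ∀ n → toℕ (U-digit n) ≢ 0
U-digit≢0 n with n % 2
... | zero  = λ ()
... | suc _ = λ ()

2*U≡U-digit+3*n : ∀ n → 2 * U n ≡ toℕ (U-digit n) + 3 * n
2*U≡U-digit+3*n n with n % 2 | n / 2 | m%n<n n 2 | m≡m%n+[m/n]*n n 2
... | suc (suc _) | _ | s≤s (s≤s ()) | _
... | zero | q | _ | n≡2q =
  trans (m*[n/m]≡n (divides (3 * q + 1) (begin
    3 * n + 2           ≡⟨ cong (λ n → 3 * n + 2) n≡2q ⟩
    3 * (0 + q * 2) + 2 ≡⟨ solve (q ∷ []) ⟩
    (3 * q + 1) * 2     ∎)))
  (+-comm (3 * n) 2)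
  where open ≡-Reasoning
... | suc zero | q | _ | n≡1+2q =
  trans (m*[n/m]≡n (divides (3 * q + 2) (begin
    3 * n + 1           ≡⟨ cong (λ n → 3 * n + 1) n≡1+2q ⟩
    3 * (1 + q * 2) + 1 ≡⟨ solve (q ∷ []) ⟩
    (3 * q + 2) * 2     ∎)))
  (+-comm (3 * n) 1)
  where open ≡-Reasoning

U-maximal : ∀ {n m M} (a : Digit) → m ≤ M → 2 * n ≡ toℕ a + 3 * m → n ≤ U M
U-maximal {n} {m} {M} a m≤M 2n≡a+3m = m<1+n⇒m≤n (*-cancelˡ-< 2 n (suc (U M)) (begin-strict
  2 * n                         ≡⟨ 2n≡a+3m ⟩
  toℕ a + 3 * m                 ≤⟨ +-mono-≤ (m<1+n⇒m≤n (toℕ<n a)) (*-monoʳ-≤ 3 m≤M) ⟩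
  2 + 3 * M                     ≤⟨ s≤s (+-monoˡ-≤ (3 * M) (n≢0⇒n>0 (U-digit≢0 M))) ⟩
  1 + (toℕ (U-digit M) + 3 * M) ≡⟨ cong suc (2*U≡U-digit+3*n M) ⟨
  1 + 2 * U M                   <⟨ n<1+n _ ⟩
  2 + 2 * U M                   ≡⟨ *-suc 2 (U M) ⟨
  2 * suc (U M)                 ∎))
  where open ≤-Reasoning

2∣3m⇒2∣m : ∀ m → 2 ∣ 3 * m → 2 ∣ m
2∣3m⇒2∣m m 2∣3m = ∣m+n∣m⇒∣n (subst (2 ∣_) (+-comm m (2 * m)) 2∣3m) (m∣m*n m)

2^j∣3m⇒2^j∣m : ∀ j m → 2 ^ j ∣ 3 * m → 2 ^ j ∣ m
2^j∣3m⇒2^j∣m zero    m _ = 1∣ m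
2^j∣3m⇒2^j∣m (suc j) m 2^[1+j]∣3m with 2∣3m⇒2∣m m (∣-trans (m∣m*n (2 ^ j)) 2^[1+j]∣3m)
... | divides q refl =
  subst (2 ^ suc j ∣_) (*-comm 2 q) (*-monoʳ-∣ 2 (2^j∣3m⇒2^j∣m j q (*-cancelˡ-∣ 2 2^[1+j]∣2*3q)))
  where
  3*[q*2]≡2*[3*q] : ∀ q → 3 * (q * 2) ≡ 2 * (3 * q)
  3*[q*2]≡2*[3*q] = solve-∀
  2^[1+j]∣2*3q : 2 ^ suc j ∣ 2 * (3 * q)
  2^[1+j]∣2*3q = subst (2 ^ suc j ∣_) (3*[q*2]≡2*[3*q] q) 2^[1+j]∣3m

RepLSB : ℕ → List Digit → Set
RepLSB n v = 2 ^ length v * n ≡ scaledValLSB v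

scaledValLSB-∷ : ∀ {m} a r → RepLSB m r → scaledValLSB (a ∷ r) ≡ 2 ^ length r * (toℕ a + 3 * m)
scaledValLSB-∷ {m} a r rep = begin
  toℕ a * P + 3 * scaledValLSB r ≡⟨ cong (λ s → toℕ a * P + 3 * s) rep ⟨
  toℕ a * P + 3 * (P * m)        ≡⟨ distrib (toℕ a) P m ⟩
  P * (toℕ a + 3 * m)            ∎
  where
  open ≡-Reasoning
  P = 2 ^ length r
  distrib : ∀ a P m → a * P + 3 * (P * m) ≡ P * (a + 3 * m)
  distrib = solve-∀

2*P*n≡P*[2*n] : ∀ P n → 2 * P * n ≡ P * (2 * n)
2*P*n≡P*[2*n] P n = trans (cong (_* n) (*-comm 2 P)) (*-assoc P 2 n)

RepLSB-∷ : ∀ {m n} a r → RepLSB m r → 2 * n ≡ toℕ a + 3 * m → RepLSB n (a ∷ r)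
RepLSB-∷ {m} {n} a r rep 2n≡a+3m = begin
  2 * P * n           ≡⟨ 2*P*n≡P*[2*n] P n ⟩
  P * (2 * n)         ≡⟨ cong (P *_) 2n≡a+3m ⟩
  P * (toℕ a + 3 * m) ≡⟨ scaledValLSB-∷ a r rep ⟨
  scaledValLSB (a ∷ r) ∎
  where
  open ≡-Reasoning
  P = 2 ^ length r

2^|r|∣scaledValLSB : ∀ {n} a r → RepLSB n (a ∷ r) → 2 ^ length r ∣ scaledValLSB r
2^|r|∣scaledValLSB {n} a r rep = 2^j∣3m⇒2^j∣m (length r) (scaledValLSB r)
  (∣m+n∣m⇒∣n (subst (2 ^ length r ∣_) rep (∣-trans (n∣m*n 2) (m∣m*n n))) (n∣m*n (toℕ a)))

RepLSB-∷⁻ : ∀ {n} a r → RepLSB n (a ∷ r) → ∃ λ m → RepLSB m r × 2 * n ≡ toℕ a + 3 * m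
RepLSB-∷⁻ {n} a r rep with 2^|r|∣scaledValLSB a r rep
... | divides m s≡m*P = m , rep′ , *-cancelˡ-≡ (2 * n) (toℕ a + 3 * m) P (begin
  P * (2 * n)          ≡⟨ 2*P*n≡P*[2*n] P n ⟨
  2 * P * n            ≡⟨ rep ⟩
  scaledValLSB (a ∷ r) ≡⟨ scaledValLSB-∷ a r rep′ ⟩
  P * (toℕ a + 3 * m)  ∎)
  where
  open ≡-Reasoning
  P = 2 ^ length r
  instance _ = m^n≢0 2 (length r)
  rep′ : RepLSB m r
  rep′ = trans (*-comm P m) (sym s≡m*P)

RepLSB⇒≤iterU : ∀ {n} v → RepLSB n v → n ≤ iter (length v) U 0
RepLSB⇒≤iterU {n} []    rep = ≤-reflexive (trans (sym (*-identityˡ n)) rep)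
RepLSB⇒≤iterU (a ∷ r) rep =
  let m , rep′ , 2n≡a+3m = RepLSB-∷⁻ a r rep in U-maximal a (RepLSB⇒≤iterU r rep′) 2n≡a+3m

satDigitsLSB : ℕ → List Digit
satDigitsLSB zero    = []
satDigitsLSB (suc k) = U-digit (iter k U 0) ∷ satDigitsLSB k

length-satDigitsLSB : ∀ k → length (satDigitsLSB k) ≡ k
length-satDigitsLSB zero    = refl
length-satDigitsLSB (suc k) = cong suc (length-satDigitsLSB k)

RepLSB-satDigitsLSB : ∀ k → RepLSB (iter k U 0) (satDigitsLSB k)
RepLSB-satDigitsLSB zero    = refl
RepLSB-satDigitsLSB (suc k) =
  RepLSB-∷ {M} {U M} (U-digit M) (satDigitsLSB k) (RepLSB-satDigitsLSB k) (2*U≡U-digit+3*n M)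
  where M = iter k U 0

LeadingNonZero-++ : ∀ u {v} → LeadingNonZero u → LeadingNonZero v → LeadingNonZero (u ++ v)
LeadingNonZero-++ []      _ lnz = lnz
LeadingNonZero-++ (_ ∷ _) lnz _ = lnz

LeadingNonZero-reverse-satDigitsLSB : ∀ k → LeadingNonZero (reverse (satDigitsLSB k))
LeadingNonZero-reverse-satDigitsLSB zero    = tt
LeadingNonZero-reverse-satDigitsLSB (suc k) =
  subst LeadingNonZero (sym (unfold-reverse _ (satDigitsLSB k)))
    (LeadingNonZero-++ (reverse (satDigitsLSB k))
      (LeadingNonZero-reverse-satDigitsLSB k) (U-digit≢0 (iter k U 0)))

IsRep⇒RepLSB : ∀ {n} w → IsRep n w → RepLSB n (reverse w)
IsRep⇒RepLSB {n} w (_ , eq) = subst (λ L → 2 ^ L * n ≡ scaledVal w) (sym (length-reverse w)) eq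

RepLSB⇒IsRep : ∀ {n} v → LeadingNonZero (reverse v) → RepLSB n v → IsRep n (reverse v)
RepLSB⇒IsRep {n} v lnz rep =
  lnz , subst₂ (λ L u → 2 ^ L * n ≡ scaledValLSB u) (sym (length-reverse v)) (sym (reverse-involutive v)) rep

iterU-representable : ∀ k → ∃ λ w → IsRep (iter k U 0) w × length w ≡ k
iterU-representable k =
  reverse v ,
  RepLSB⇒IsRep v (LeadingNonZero-reverse-satDigitsLSB k) (RepLSB-satDigitsLSB k) ,
  trans (length-reverse v) (length-satDigitsLSB k)
  where v = satDigitsLSB k

IsRep⇒≤iterU : ∀ {n} w → IsRep n w → n ≤ iter (length w) U 0
IsRep⇒≤iterU {n} w rep =
  subst (λ L → n ≤ iter L U 0) (length-reverse w) (RepLSB⇒≤iterU (reverse w) (IsRep⇒RepLSB w rep))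

proposition16 : (k : ℕ) → 1 ≤ k → IsSat k (iter k U 0)
proposition16 k _ =
  iterU-representable k ,
  λ n w rep |w|≡k → subst (λ L → n ≤ iter L U 0) |w|≡k (IsRep⇒≤iterU w rep)
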